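{- Let $X$ be a topological space satisfying ${\sf S}_1(\Omega_X,\Omega_X)$ and let $A\in\Omega_X$ be countable with a fixed bijective enumeration. If $R$ and $S$ are completely Ramsey subsets of $[A]^{\aleph_0}\cap\Omega_X$, then $R\cap S$ is completely Ramsey.
   Context: An $\omega$-cover of $X$ is an open cover $\mathcal{U}$ with $X\notin\mathcal{U}$ such that each finite subset of $X$ lies in some member of $\mathcal{U}$; $\Omega_X$ is the set of $\omega$-covers. ${\sf S}_1(\Omega_X,\Omega_X)$: for every sequence of $\omega$-covers $(\mathcal{U}_n)$ there are $U_n\in\mathcal{U}_n$ with $\{U_n:n\in\mathbb{N}\}$ an $\omega$-cover. $[S]^{\aleph_0}$ denotes the countably infinite subsets of $S$. With the enumeration $A=\{a_n:n\in\mathbb{N}\}$: for $s,T\subseteq A$, $s<T$ means $a_n\in s$, $a_m\in T$ imply $n<m$; $B|s=\{a_n\in B:s<\{a_n\}\}$; for finite $s$ and infinite $C$ with $s<C$, $[s,C]=\{s\cup D: D\in[A]^{\aleph_0},D\subseteq C\}$. A set $R\subseteq[A]^{\aleph_0}\cap\Omega_X$ is completely Ramsey if for every finite $s\subseteq A$ and every $B\in[A|s]^{\aleph_0}\cap\Omega_X$ there is $C\in[B]^{\aleph_0}\cap\Omega_X$ with either $[s,C]\cap\Omega_X\subseteq R$ or $[s,C]\cap\Omega_X\cap R=\emptyset$. -}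

module Defs where

open import Data.Nat using (ℕ; _≤_; _<_)
open import Data.Product using (Σ; ∃; _×_; _,_; proj₁)
open import Data.Sum using (_⊎_)
open import Data.Empty using (⊥)
open import Data.Unit using (⊤)
open import Data.List using (List)
open import Data.List.Relation.Unary.All using (All)
open import Data.List.Membership.Propositional using (_∈_)
open import Relation.Nullary using (¬_)
open import Function.Bundles using (_⇔_)

Sub : Set → Set₁
Sub X = X → Set

record Topology (X : Set) : Set₁ where
  field
    Open       : Sub X → Set
    open-whole : Open (λ _ → ⊤)
    open-empty : Open (λ _ → ⊥)
    open-⋃     : (I : Set) (F : I → Sub X) → (∀ i → Open (F i)) →
                 Open (λ x → Σ I (λ i → F i x))
    open-∩     : (U V : Sub X) → Open U → Open V → Open (λ x → U x × V x)
    open-ext   : (U V : Sub X) → (∀ x → U x ⇔ V x) → Open U → Open V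

open Topology public

-- An ω-cover, given as an indexed family F : I → Sub X of subsets of X:
-- every member is open, X is not a member, every finite subset of X lies in a member.
IsΩ : {X : Set} → Topology X → (I : Set) → (I → Sub X) → Set
IsΩ {X} τ I F =
  (∀ i → Open τ (F i)) ×
  (¬ Σ I (λ i → ∀ x → F i x)) ×
  ((xs : List X) → Σ I (λ i → All (F i) xs))

S1ΩΩ : {X : Set} → Topology X → Set₁
S1ΩΩ {X} τ =
  (I : ℕ → Set) (𝒰 : (n : ℕ) → I n → Sub X) → (∀ n → IsΩ τ (I n) (𝒰 n)) →
  Σ ((n : ℕ) → I n) (λ f → IsΩ τ ℕ (λ n → 𝒰 n (f n)))

-- Subsets of A = {a n : n ∈ ℕ} are represented by index sets B : Sub ℕ.
Infinite : Sub ℕ → Set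
Infinite B = ∀ n → ∃ (λ m → n ≤ m × B m)

_⊆_ : Sub ℕ → Sub ℕ → Set
B ⊆ C = ∀ n → B n → C n

IsΩSub : {X : Set} → Topology X → (ℕ → Sub X) → Sub ℕ → Set
IsΩSub τ a B = IsΩ τ (Σ ℕ B) (λ p → a (proj₁ p))

⟦_⟧ : List ℕ → Sub ℕ
⟦ s ⟧ n = n ∈ s

_∣_ : Sub ℕ → List ℕ → Sub ℕ
(B ∣ s) m = B m × (∀ n → n ∈ s → n < m)

_∪_ : Sub ℕ → Sub ℕ → Sub ℕ
(B ∪ C) n = B n ⊎ C n

AllIdx : Sub ℕ
AllIdx _ = ⊤

BoxIn : {X : Set} → Topology X → (ℕ → Sub X) → (Sub ℕ → Set) → List ℕ → Sub ℕ → Set₁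
BoxIn τ a R s C =
  (D : Sub ℕ) → D ⊆ C → Infinite D → IsΩSub τ a (⟦ s ⟧ ∪ D) → R (⟦ s ⟧ ∪ D)

BoxOut : {X : Set} → Topology X → (ℕ → Sub X) → (Sub ℕ → Set) → List ℕ → Sub ℕ → Set₁
BoxOut τ a R s C =
  (D : Sub ℕ) → D ⊆ C → Infinite D → IsΩSub τ a (⟦ s ⟧ ∪ D) → ¬ R (⟦ s ⟧ ∪ D)

-- R ⊆ [A]^ℵ₀ ∩ Ω_X, R a genuine (extensional) set of subsets of A
IsFamilyIn : {X : Set} → Topology X → (ℕ → Sub X) → (Sub ℕ → Set) → Set₁
IsFamilyIn τ a R =
  ((B : Sub ℕ) → R B → Infinite B × IsΩSub τ a B) ×
  ((B C : Sub ℕ) → (∀ n → B n ⇔ C n) → R B → R C)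

CompletelyRamsey : {X : Set} → Topology X → (ℕ → Sub X) → (Sub ℕ → Set) → Set₁
CompletelyRamsey τ a R =
  (s : List ℕ) (B : Sub ℕ) → B ⊆ (AllIdx ∣ s) → Infinite B → IsΩSub τ a B →
  Σ (Sub ℕ) (λ C → C ⊆ B × Infinite C × IsΩSub τ a C ×
     (BoxIn τ a R s C ⊎ BoxOut τ a R s C))

_∩ᴿ_ : (Sub ℕ → Set) → (Sub ℕ → Set) → (Sub ℕ → Set)
(R ∩ᴿ S) B = R B × S B

module Submission where

-- Shrink B to an ω-cover C₁ homogeneous for R, then C₁ to an ω-cover C₂
-- homogeneous for S. Homogeneity passes to subsets, so C₂ is homogeneous for
-- both, and hence for R ∩ S: inside both or outside one of them.

open import Defs
open import Data.Nat using (ℕ)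
open import Data.List using (List)
open import Data.Product using (_,_)
open import Data.Sum using (_⊎_; inj₁; inj₂)
open import Function.Bundles using (_⇔_)
open import Relation.Binary.PropositionalEquality using (_≡_)

⊆-trans : {B C D : Sub ℕ} → B ⊆ C → C ⊆ D → B ⊆ D
⊆-trans B⊆C C⊆D n b = C⊆D n (B⊆C n b)

module _ {X : Set} (τ : Topology X) (a : ℕ → Sub X) where

  Homogeneous : (Sub ℕ → Set) → List ℕ → Sub ℕ → Set₁
  Homogeneous R s C = BoxIn τ a R s C ⊎ BoxOut τ a R s C

  module _ (R : Sub ℕ → Set) {s : List ℕ} {C C′ : Sub ℕ} (C′⊆C : C′ ⊆ C) where

    BoxIn-antitone : BoxIn τ a R s C → BoxIn τ a R s C′
    BoxIn-antitone inR D D⊆C′ = inR D (⊆-trans D⊆C′ C′⊆C)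

    BoxOut-antitone : BoxOut τ a R s C → BoxOut τ a R s C′
    BoxOut-antitone outR D D⊆C′ = outR D (⊆-trans D⊆C′ C′⊆C)

    Homogeneous-antitone : Homogeneous R s C → Homogeneous R s C′
    Homogeneous-antitone (inj₁ inR)  = inj₁ (BoxIn-antitone inR)
    Homogeneous-antitone (inj₂ outR) = inj₂ (BoxOut-antitone outR)

  module _ (R S : Sub ℕ → Set) {s : List ℕ} {C : Sub ℕ} where

    BoxIn-∩ : BoxIn τ a R s C → BoxIn τ a S s C → BoxIn τ a (R ∩ᴿ S) s C
    BoxIn-∩ inR inS D D⊆C Dinf DΩ = inR D D⊆C Dinf DΩ , inS D D⊆C Dinf DΩ

    BoxOut-∩ˡ : BoxOut τ a R s C → BoxOut τ a (R ∩ᴿ S) s C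
    BoxOut-∩ˡ outR D D⊆C Dinf DΩ (r , _) = outR D D⊆C Dinf DΩ r

    BoxOut-∩ʳ : BoxOut τ a S s C → BoxOut τ a (R ∩ᴿ S) s C
    BoxOut-∩ʳ outS D D⊆C Dinf DΩ (_ , r) = outS D D⊆C Dinf DΩ r

    Homogeneous-∩ : Homogeneous R s C → Homogeneous S s C → Homogeneous (R ∩ᴿ S) s C
    Homogeneous-∩ (inj₁ inR)  (inj₁ inS)  = inj₁ (BoxIn-∩ inR inS)
    Homogeneous-∩ (inj₁ _)    (inj₂ outS) = inj₂ (BoxOut-∩ʳ outS)
    Homogeneous-∩ (inj₂ outR) _           = inj₂ (BoxOut-∩ˡ outR)

corollary1 : {X : Set} (τ : Topology X) → S1ΩΩ τ →
    (a : ℕ → Sub X) → ((n m : ℕ) → (∀ x → a n x ⇔ a m x) → n ≡ m) →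
    IsΩSub τ a AllIdx →
    (R S : Sub ℕ → Set) → IsFamilyIn τ a R → IsFamilyIn τ a S →
    CompletelyRamsey τ a R → CompletelyRamsey τ a S →
    CompletelyRamsey τ a (R ∩ᴿ S)
corollary1 τ _ a _ _ R S _ _ ramseyR ramseyS s B B⊆A|s Binf BΩ
  with ramseyR s B B⊆A|s Binf BΩ
... | C₁ , C₁⊆B , C₁inf , C₁Ω , homR
  with ramseyS s C₁ (⊆-trans C₁⊆B B⊆A|s) C₁inf C₁Ω
... | C₂ , C₂⊆C₁ , C₂inf , C₂Ω , homS =
  C₂ , ⊆-trans C₂⊆C₁ C₁⊆B , C₂inf , C₂Ω ,
  Homogeneous-∩ τ a R S (Homogeneous-antitone τ a R C₂⊆C₁ homR) homS
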